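{- A finite order $P$ is a unit parallelogram order if and only if $P$ has semiorder dimension at most $2$, i.e. $P$ is the intersection of two (possibly identical) semiorders on its ground set.
   Context: A trapezoid representation of an order uses two parallel baselines. Each element $x$ is assigned a closed interval $[l(x),r(x)]$ on the lower baseline and a closed interval $[L(x),R(x)]$ on the upper baseline, and its trapezoid $T_x$ is the convex hull of these two intervals. The representation requires $x\prec y$ if and only if $r(x)<l(y)$ and $R(x)<L(y)$. A unit parallelogram order is one having such a representation with two properties: - for each $x$, the upper and lower intervals of $x$ have the same length; - all trapezoids have the same area, equivalently the sum of the two base lengths is the same for all elements. A semiorder is an order representable by closed real intervals all of the same length, with $x<y$ if and only if the interval of $x$ lies entirely to the left of that of $y$. The intersection of two orders on the same ground set has $x<y$ if and only if $x<y$ in both orders.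
   Formalization: The interval endpoints and common lengths of the semiorder representations, and the interval endpoints and common area of the trapezoid representations, are rational rather than real. -}

module Defs where

open import Level using (0ℓ)
open import Data.Nat using (ℕ)
open import Data.Fin using (Fin)
open import Data.Product using (Σ; _×_; ∃)
open import Data.Rational using (ℚ; _+_; _-_; _<_; _≤_; 0ℚ)
open import Relation.Binary using (Rel)
open import Relation.Binary.PropositionalEquality using (_≡_)
open import Function.Bundles using (_⇔_)

-- R is a semiorder: there are a common length c ≥ 0 and left endpoints f
-- such that x R y iff the closed interval [f x, f x + c] lies entirely to
-- the left of [f y, f y + c], i.e. f x + c < f y.
IsSemiorder : {n : ℕ} → Rel (Fin n) 0ℓ → Set
IsSemiorder {n} R =
  Σ ℚ λ c → (0ℚ ≤ c) × Σ (Fin n → ℚ) λ f →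
    (∀ x y → R x y ⇔ (f x + c < f y))

SemiorderDim≤2 : {n : ℕ} → Rel (Fin n) 0ℓ → Set₁
SemiorderDim≤2 {n} P =
  Σ (Rel (Fin n) 0ℓ) λ S₁ → Σ (Rel (Fin n) 0ℓ) λ S₂ →
    IsSemiorder S₁ × IsSemiorder S₂ ×
    (∀ x y → P x y ⇔ (S₁ x y × S₂ x y))

-- A trapezoid representation: lower interval [l x, r x], upper interval
-- [L x, R x], with x ≺ y iff r x < l y and R x < L y.
record TrapezoidRep {n : ℕ} (P : Rel (Fin n) 0ℓ) : Set where
  field
    l r L R : Fin n → ℚ
    lower-ok : ∀ x → l x ≤ r x
    upper-ok : ∀ x → L x ≤ R x
    represents : ∀ x y → P x y ⇔ ((r x < l y) × (R x < L y))

IsUnitParallelogramOrder : {n : ℕ} → Rel (Fin n) 0ℓ → Set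
IsUnitParallelogramOrder {n} P =
  Σ (TrapezoidRep P) λ T →
    let open TrapezoidRep T in
    (∀ x → R x - L x ≡ r x - l x) ×
    Σ ℚ (λ A → ∀ x → (r x - l x) + (R x - L x) ≡ A)

{-# OPTIONS --safe #-}
-- In a unit parallelogram representation each trapezoid has two bases of the
-- same length whose sum is the common area, so every base has length half the
-- area: the lower intervals and the upper intervals are two semiorders whose
-- intersection is the order.  Conversely every finite semiorder has a
-- representation by intervals of length exactly 1 (enlarge the length slightly,
-- then rescale), and the unit intervals of two semiorders are the two bases of
-- unit parallelograms representing their intersection.
module Submission where

open import Defs
open import Level using (0ℓ)
open import Data.Nat using (ℕ)
open import Data.Fin using (Fin)
open import Relation.Binary using (Rel; IsStrictPartialOrder)
open import Relation.Binary.PropositionalEquality using (_≡_)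
open import Function.Bundles using (_⇔_)
open import Data.Product using (_×_)

open import Data.Nat using (zero; suc)
open import Data.Fin using (zero; suc)
open import Data.Product using (Σ; _,_; proj₁)
open import Data.Product.Function.NonDependent.Propositional using (_×-⇔_)
open import Data.Sum using (inj₁; inj₂)
open import Function using (_∘_)
open import Function.Bundles using (mk⇔)
open import Function.Construct.Composition using (_⇔-∘_)
open import Relation.Nullary using (yes; no; contradiction)
open import Relation.Binary.PropositionalEquality using (refl; sym; trans; cong; cong₂; subst)
open import Data.Rational
open import Data.Rational.Properties
open import Data.Rational.Solver using (module +-*-Solver)
open +-*-Solver using (solve; _:+_; _:-_; _:*_; con; _:=_)

p+q-p≡q : ∀ p q → p + q - p ≡ q
p+q-p≡q = solve 2 (λ p q → p :+ q :- p := q) refl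

p+[q-p]≡q : ∀ p q → p + (q - p) ≡ q
p+[q-p]≡q = solve 2 (λ p q → p :+ (q :- p) := q) refl

[p+p]*½≡p : ∀ p → (p + p) * ½ ≡ p
[p+p]*½≡p = solve 1 (λ p → (p :+ p) :* con ½ := p) refl

p*½+p*½≡p : ∀ p → p * ½ + p * ½ ≡ p
p*½+p*½≡p = solve 1 (λ p → p :* con ½ :+ p :* con ½ := p) refl

p+p≡q+q⇒p≡q : ∀ {p q} → p + p ≡ q + q → p ≡ q
p+p≡q+q⇒p≡q {p} {q} eq = trans (sym ([p+p]*½≡p p)) (trans (cong (_* ½) eq) ([p+p]*½≡p q))

p≤q⇒0≤q-p : ∀ {p q} → p ≤ q → 0ℚ ≤ q - p
p≤q⇒0≤q-p {p} {q} p≤q = subst (_≤ q - p) (+-inverseʳ p) (+-monoˡ-≤ (- p) p≤q)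

p<q⇒0<q-p : ∀ {p q} → p < q → 0ℚ < q - p
p<q⇒0<q-p {p} {q} p<q = subst (_< q - p) (+-inverseʳ p) (+-monoˡ-< (- p) p<q)

p≤p+q : ∀ p {q} → 0ℚ ≤ q → p ≤ p + q
p≤p+q p {q} 0≤q = subst (_≤ p + q) (+-identityʳ p) (+-monoʳ-≤ p 0≤q)

p<p+q : ∀ p {q} → 0ℚ < q → p < p + q
p<p+q p {q} 0<q = subst (_< p + q) (+-identityʳ p) (+-monoʳ-< p 0<q)

0<p⇒0<p*½ : ∀ {p} → 0ℚ < p → 0ℚ < p * ½
0<p⇒0<p*½ {p} 0<p = subst (_< p * ½) (*-zeroˡ ½) (*-monoˡ-<-pos ½ 0<p)

0<p⇒p*½<p : ∀ {p} → 0ℚ < p → p * ½ < p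
0<p⇒p*½<p {p} 0<p = subst (p * ½ <_) (p*½+p*½≡p p) (p<p+q (p * ½) (0<p⇒0<p*½ 0<p))

SemiorderRep : {n : ℕ} → Rel (Fin n) 0ℓ → ℚ → (Fin n → ℚ) → Set
SemiorderRep R c f = ∀ x y → R x y ⇔ (f x + c < f y)

equalWidths⇒isSemiorder : ∀ {n} (l r : Fin n → ℚ) → (∀ x → l x ≤ r x) →
                          (∀ x y → r x - l x ≡ r y - l y) →
                          IsSemiorder (λ x y → r x < l y)
equalWidths⇒isSemiorder {zero}  l r _   _    = 0ℚ , ≤-refl , l , λ ()
equalWidths⇒isSemiorder {suc n} l r l≤r same = c , p≤q⇒0≤q-p (l≤r zero) , l , rep
  where
  c : ℚ
  c = r zero - l zero
  r≡l+c : ∀ x → r x ≡ l x + c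
  r≡l+c x = trans (sym (p+[q-p]≡q (l x) (r x))) (cong (l x +_) (same x zero))
  rep : SemiorderRep (λ x y → r x < l y) c l
  rep x y = mk⇔ (subst (_< l y) (r≡l+c x)) (subst (_< l y) (sym (r≡l+c x)))

unitParallelogram⇒semiorderDim≤2 : ∀ {n} {P : Rel (Fin n) 0ℓ} →
                                   IsUnitParallelogramOrder P → SemiorderDim≤2 P
unitParallelogram⇒semiorderDim≤2 (T , upper≡lower , A , area) =
  (λ x y → r x < l y) , (λ x y → R x < L y) ,
  equalWidths⇒isSemiorder l r lower-ok lowerSame ,
  equalWidths⇒isSemiorder L R upper-ok upperSame ,
  represents
  where
  open TrapezoidRep T
  doubleLower≡A : ∀ x → (r x - l x) + (r x - l x) ≡ A
  doubleLower≡A x = trans (cong ((r x - l x) +_) (sym (upper≡lower x))) (area x)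
  lowerSame : ∀ x y → r x - l x ≡ r y - l y
  lowerSame x y = p+p≡q+q⇒p≡q (trans (doubleLower≡A x) (sym (doubleLower≡A y)))
  upperSame : ∀ x y → R x - L x ≡ R y - L y
  upperSame x y = trans (upper≡lower x) (trans (lowerSame x y) (sym (upper≡lower y)))

0<p⊓q : ∀ {p q} → 0ℚ < p → 0ℚ < q → 0ℚ < p ⊓ q
0<p⊓q {p} {q} 0<p 0<q with ⊓-sel p q
... | inj₁ p⊓q≡p = subst (0ℚ <_) (sym p⊓q≡p) 0<p
... | inj₂ p⊓q≡q = subst (0ℚ <_) (sym p⊓q≡q) 0<q

positiveLowerBound : ∀ {m} (g : Fin m → ℚ) →
                     Σ ℚ λ δ → 0ℚ < δ × (∀ i → 0ℚ < g i → δ ≤ g i)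
positiveLowerBound {zero}  g = 1ℚ , positive⁻¹ 1ℚ , λ ()
positiveLowerBound {suc m} g with positiveLowerBound (g ∘ suc) | 0ℚ <? g zero
... | δ , 0<δ , δ≤ | no g₀≯0 = δ , 0<δ , λ
  { zero    0<g₀ → contradiction 0<g₀ g₀≯0
  ; (suc i) 0<gᵢ → δ≤ i 0<gᵢ }
... | δ , 0<δ , δ≤ | yes 0<g₀ = δ ⊓ g zero , 0<p⊓q 0<δ 0<g₀ , λ
  { zero    _    → p⊓q≤q δ (g zero)
  ; (suc i) 0<gᵢ → p≤q⇒p⊓r≤q (g zero) (δ≤ i 0<gᵢ) }

positiveLowerBound² : ∀ {m k} (g : Fin m → Fin k → ℚ) →
                      Σ ℚ λ δ → 0ℚ < δ × (∀ i j → 0ℚ < g i j → δ ≤ g i j)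
positiveLowerBound² g with positiveLowerBound (λ i → proj₁ (positiveLowerBound (g i)))
... | δ , 0<δ , δ≤ = δ , 0<δ , λ i j 0<gᵢⱼ →
  let δᵢ , 0<δᵢ , δᵢ≤ = positiveLowerBound (g i) in ≤-trans (δ≤ i 0<δᵢ) (δᵢ≤ j 0<gᵢⱼ)

-- The length can be raised by less than the least positive slack f y - (f x + c)
-- without changing the relation; this removes the degenerate length 0.
isSemiorder⇒positiveLength : ∀ {n} {S : Rel (Fin n) 0ℓ} → IsSemiorder S →
                             Σ ℚ λ d → 0ℚ < d × Σ (Fin n → ℚ) (SemiorderRep S d)
isSemiorder⇒positiveLength (c , 0≤c , f , rep)
  with positiveLowerBound² (λ x y → f y - (f x + c))
... | δ , 0<δ , δ≤slack =
  c + ε , ≤-<-trans 0≤c (p<p+q c 0<ε) , f , λ x y → widen x y ⇔-∘ rep x y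
  where
  ε : ℚ
  ε = δ * ½
  0<ε : 0ℚ < ε
  0<ε = 0<p⇒0<p*½ 0<δ
  widen : ∀ x y → (f x + c < f y) ⇔ (f x + (c + ε) < f y)
  widen x y = mk⇔ raise (≤-<-trans (+-monoʳ-≤ (f x) (p≤p+q c (<⇒≤ 0<ε))))
    where
    raise : f x + c < f y → f x + (c + ε) < f y
    raise lt = begin-strict
      f x + (c + ε)                  ≡⟨ sym (+-assoc (f x) c ε) ⟩
      f x + c + ε                    <⟨ +-monoʳ-< (f x + c) (0<p⇒p*½<p 0<δ) ⟩
      f x + c + δ                    ≤⟨ +-monoʳ-≤ (f x + c) (δ≤slack x y (p<q⇒0<q-p lt)) ⟩
      f x + c + (f y - (f x + c))    ≡⟨ p+[q-p]≡q (f x + c) (f y) ⟩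
      f y                            ∎
      where open ≤-Reasoning

SemiorderRep-scale : ∀ {n} {S : Rel (Fin n) 0ℓ} {c f} k .{{_ : Positive k}} →
                     SemiorderRep S c f → SemiorderRep S (c * k) (λ x → f x * k)
SemiorderRep-scale {c = c} {f} k rep x y = scale ⇔-∘ rep x y
  where
  scale : (f x + c < f y) ⇔ (f x * k + c * k < f y * k)
  scale = mk⇔
    (λ lt → subst (_< f y * k) (*-distribʳ-+ k (f x) c) (*-monoˡ-<-pos k lt))
    (λ lt → *-cancelʳ-<-nonNeg k {{pos⇒nonNeg k}}
              (subst (_< f y * k) (sym (*-distribʳ-+ k (f x) c)) lt))

positiveLength⇒unitLength : ∀ {n} {S : Rel (Fin n) 0ℓ} d → 0ℚ < d →
                            Σ (Fin n → ℚ) (SemiorderRep S d) →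
                            Σ (Fin n → ℚ) (SemiorderRep S 1ℚ)
positiveLength⇒unitLength {S = S} d 0<d (f , rep) =
  g , subst (λ e → SemiorderRep S e g) (*-inverseʳ d {{d≢0}})
            (SemiorderRep-scale d⁻¹ {{1/pos⇒pos d}} rep)
  where
  instance
    d-positive : Positive d
    d-positive = positive 0<d
  d≢0 : NonZero d
  d≢0 = pos⇒nonZero d
  d⁻¹ : ℚ
  d⁻¹ = (1/ d) {{d≢0}}
  g : Fin _ → ℚ
  g x = f x * d⁻¹

isSemiorder⇒unitLength : ∀ {n} {S : Rel (Fin n) 0ℓ} → IsSemiorder S →
                         Σ (Fin n → ℚ) (SemiorderRep S 1ℚ)
isSemiorder⇒unitLength s =
  let d , 0<d , rep = isSemiorder⇒positiveLength s in positiveLength⇒unitLength d 0<d rep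

unitRepsIntersection⇒unitParallelogram :
  ∀ {n} {P S₁ S₂ : Rel (Fin n) 0ℓ} {f g : Fin n → ℚ} →
  SemiorderRep S₁ 1ℚ f → SemiorderRep S₂ 1ℚ g → (∀ x y → P x y ⇔ (S₁ x y × S₂ x y)) →
  IsUnitParallelogramOrder P
unitRepsIntersection⇒unitParallelogram {P = P} {f = f} {g} rep₁ rep₂ P⇔S₁×S₂ =
  T , (λ x → trans (width g x) (sym (width f x))) ,
  (1ℚ + 1ℚ , λ x → cong₂ _+_ (width f x) (width g x))
  where
  width : ∀ (h : Fin _ → ℚ) x → h x + 1ℚ - h x ≡ 1ℚ
  width h x = p+q-p≡q (h x) 1ℚ
  T : TrapezoidRep P
  T = record
    { l = f ; r = λ x → f x + 1ℚ
    ; L = g ; R = λ x → g x + 1ℚ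
    ; lower-ok = λ x → p≤p+q (f x) (nonNegative⁻¹ 1ℚ)
    ; upper-ok = λ x → p≤p+q (g x) (nonNegative⁻¹ 1ℚ)
    ; represents = λ x y → (rep₁ x y ×-⇔ rep₂ x y) ⇔-∘ P⇔S₁×S₂ x y
    }

semiorderDim≤2⇒unitParallelogram : ∀ {n} {P : Rel (Fin n) 0ℓ} →
                                   SemiorderDim≤2 P → IsUnitParallelogramOrder P
semiorderDim≤2⇒unitParallelogram (S₁ , S₂ , s₁ , s₂ , P⇔S₁×S₂) =
  let _ , rep₁ = isSemiorder⇒unitLength s₁
      _ , rep₂ = isSemiorder⇒unitLength s₂
  in unitRepsIntersection⇒unitParallelogram rep₁ rep₂ P⇔S₁×S₂

lemma8 : (n : ℕ) (P : Rel (Fin n) 0ℓ) → IsStrictPartialOrder _≡_ P →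
    (IsUnitParallelogramOrder P → SemiorderDim≤2 P) × (SemiorderDim≤2 P → IsUnitParallelogramOrder P)
lemma8 n P _ = unitParallelogram⇒semiorderDim≤2 , semiorderDim≤2⇒unitParallelogram
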